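{- Let $L\subseteq \Sigma^*$ be a context-free language over a finite alphabet $\Sigma$. Then there is a constant $p>0$ such that the following holds. Let $n\in\mathbb{N}$, let $R\subseteq L$ be any collection of words of length $n$, and let $D,E\subseteq\{1,\dots,n\}$ be sets of positions (the "distinguished" and "excluded" positions, used for every word of $R$) with $|D|=d$, $|E|=e$ and $d\ge p(e+1)$. Then there is a subset $Z=\{z_1,\ldots,z_k\}\subseteq R$ with $k\ge |R|/(pn^4)$, and a decomposition $z_i=u_iv_iw_ix_iy_i$ for every $1\le i\le k$ such that (1) the lengths $|u_i|,|v_i|,|w_i|,|x_i|,|y_i|$ are all independent of $i$; (2) the set of positions of $z_i$ occupied by $v_i$ or by $x_i$ contains at least one position in $D$ and no position in $E$; (3) for every $m\ge 0$ and every sequence of indices $1\le i_0,i_1,\ldots,i_{m+1}\le k$, the word $u_{i_0}v_{i_1}\cdots v_{i_m}w_{i_{m+1}}x_{i_m}\cdots x_{i_1}y_{i_0}$ belongs to $L$.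
   Context: Positions of a word of length $n$ are indexed $1,\dots,n$ from left to right. Since all words in $R$ have the same length $n$ and the lengths in (1) do not depend on $i$, the positions occupied by $v_i$ and $x_i$ are the same for all $i$. -}

module Defs where

open import Data.Nat using (ℕ; _+_; _≤_; _<_)
open import Data.Fin using (Fin)
open import Data.List using (List; []; _∷_; _++_)
open import Data.List.Membership.Propositional using (_∈_)
open import Data.Product using (_×_; Σ)
open import Data.Sum using (_⊎_)
open import Function.Bundles using (_⇔_)

Word : ℕ → Set
Word s = List (Fin s)

Language : ℕ → Set₁
Language s = Word s → Set

Symbol : ℕ → ℕ → Set
Symbol N s = Fin N ⊎ Fin s

record CFG (s : ℕ) : Set where
  field
    N     : ℕ
    start : Fin N
    rules : List (Fin N × List (Symbol N s))

open CFG public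

open import Data.Product using (_,_)
open import Data.Sum using (inj₁; inj₂)

-- Derivations (parse trees): Derives G A w means A ⇒* w (w terminal);
-- DerivesSeq G α w means the sentential form α ⇒* w.
mutual
  data Derives {s : ℕ} (G : CFG s) : Fin (N G) → Word s → Set where
    rule : ∀ {A rhs w} → (A , rhs) ∈ rules G → DerivesSeq G rhs w → Derives G A w

  data DerivesSeq {s : ℕ} (G : CFG s) : List (Symbol (N G) s) → Word s → Set where
    done : DerivesSeq G [] []
    term : ∀ {a rest w} → DerivesSeq G rest w → DerivesSeq G (inj₂ a ∷ rest) (a ∷ w)
    nont : ∀ {A rest w₁ w₂} → Derives G A w₁ → DerivesSeq G rest w₂ →
           DerivesSeq G (inj₁ A ∷ rest) (w₁ ++ w₂)

LangOf : ∀ {s} → CFG s → Language s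
LangOf G w = Derives G (start G) w

record IsContextFree {s : ℕ} (L : Language s) : Set₁ where
  field
    grammar   : CFG s
    generates : ∀ w → (L w ⇔ LangOf grammar w)

-- Position j (0-based) is occupied by v or by x in a decomposition
-- u v w x y whose pieces have lengths lu lv lw lx.
OccupiedByVX : ℕ → ℕ → ℕ → ℕ → ℕ → Set
OccupiedByVX lu lv lw lx j =
  (lu ≤ j × j < lu + lv) ⊎ (lu + lv + lw ≤ j × j < lu + lv + lw + lx)

-- Fix a grammar with N nonterminals and right-hand sides of length at most c.  An open loop at
-- a node of the parse tree of z is a derivation B ⇒* v A x ending at that node whose v and x
-- contain a distinguished and no excluded mark.  Walk down from the root, keeping more
-- distinguished marks below the current node than threshold f e, where e counts the excluded
-- marks below it and f the nonterminals heading no open loop.  If the node's label heads an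
-- open loop, that loop is the pump.  Otherwise the children's thresholds sum to at most the
-- node's (sum-childThreshold≤threshold), so the walk can move to a child exceeding its own.
-- If that child holds all excluded marks of the node, the open loops extend through the step,
-- and a new one headed by the node's label opens when the rest of the node holds a
-- distinguished mark; otherwise all loops are dropped and f is reset to N.  Since
-- threshold N e ≤ p (e + 1) ≤ |D|, every word of R has a pump.  Classifying the pumps by head
-- and by the lengths of u, v, w, x gives at most N (n + 1)^4 ≤ p n^4 classes; within the
-- largest class the heads agree, so pieces of different words can be recombined.

module Submission where

open import Defs
open import Data.Nat
open import Data.Nat.Properties
open import Data.Nat.ListAction using (sum)
open import Data.Nat.Tactic.RingSolver using (solve-∀)
open import Algebra.Properties.CommutativeSemigroup +-commutativeSemigroup using (x∙yz≈y∙xz)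
open import Data.Fin using (Fin; toℕ; zero; suc)
open import Data.Fin.Properties using (toℕ-injective; any?) renaming (_≟_ to _≟ᶠ_)
open import Data.Fin.Subset using (Subset; _∈_; _∉_; ∣_∣; inside; outside; ⊤; _-_)
open import Data.Fin.Subset.Properties
  using (_∈?_; ∣p∣≤n; ∈⊤; p⊆q⇒∣p∣≤∣q∣; x∈p⇒∣p-x∣<∣p∣; x∈p∧x≢y⇒x∈p-y)
open import Data.Vec.Base using ([]; _∷_; here; there)
open import Data.List using (List; []; _∷_; _++_; [_]; length; map; foldr; filter; lookup;
  concat; concatMap; reverse; upTo; allFin; cartesianProduct)
open import Data.List.Properties
  using (++-assoc; ++-identityʳ; length-++; length-map; length-upTo; length-tabulate;
         map-++; map-cong; concat-++; unfold-reverse)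
open import Data.List.Relation.Unary.All using (All; []; _∷_)
import Data.List.Relation.Unary.All as All
import Data.List.Relation.Unary.All.Properties as All
open import Data.List.Relation.Unary.Unique.Propositional using (Unique)
open import Data.List.Relation.Unary.AllPairs using ([]; _∷_)
open import Data.List.Membership.Propositional.Properties
  using (∈-lookup; ∈-map⁺; ∈-filter⁻; ∈-allFin; ∈-upTo⁺; ∈-cartesianProduct⁺)
open import Data.List.Membership.Propositional using () renaming (_∈_ to _∈ₗ_; _∉_ to _∉ₗ_)
open import Data.List.Relation.Unary.Any using (here; there)
open import Data.List.Membership.DecPropositional _≟_ using () renaming (_∈?_ to _∈ₗ?_)
open import Data.Product using (_×_; Σ; ∃-syntax; _,_; proj₁; proj₂)
open import Data.Product.Properties using (≡-dec)
open import Data.Sum using (_⊎_; inj₁; inj₂)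
open import Data.Empty using (⊥-elim)
open import Relation.Nullary using (yes; no; does; ¬?; _×-dec_)
open import Relation.Unary using (Decidable)
open import Data.Bool using (true; false)
open import Relation.Binary.Definitions using (DecidableEquality)
open import Function.Bundles using (Equivalence)
open import Function.Definitions using (Injective)
open import Relation.Binary.PropositionalEquality hiding ([_])

m≤n∧n+o<m+p⇒o<p : ∀ {m n o p} → m ≤ n → n + o < m + p → o < p
m≤n∧n+o<m+p⇒o<p {m} {n} {o} {p} m≤n n+o<m+p = +-cancelˡ-< m o p (≤-<-trans (+-monoˡ-≤ o m≤n) n+o<m+p)

m+[n+o]≡n⇒m≡0×o≡0 : ∀ m n o → m + (n + o) ≡ n → m ≡ 0 × o ≡ 0
m+[n+o]≡n⇒m≡0×o≡0 m n o h = m+n≡0⇒m≡0 m m+o≡0 , m+n≡0⇒n≡0 m m+o≡0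
  where
  m+o≡0 : m + o ≡ 0
  m+o≡0 = +-cancelˡ-≡ n _ _ (trans (x∙yz≈y∙xz n m o) (trans h (sym (+-identityʳ n))))

n≢m+[n+o]⇒1≤m+o : ∀ m n o → n ≢ m + (n + o) → 1 ≤ m + o
n≢m+[n+o]⇒1≤m+o zero    n zero    n≢ = ⊥-elim (n≢ (sym (+-identityʳ n)))
n≢m+[n+o]⇒1≤m+o zero    n (suc o) _  = s≤s z≤n
n≢m+[n+o]⇒1≤m+o (suc m) n o       _  = s≤s z≤n

-- Counting marked positions in an interval

intervalSum : (ℕ → ℕ) → ℕ → ℕ → ℕ
intervalSum f o zero    = 0
intervalSum f o (suc l) = f o + intervalSum f (suc o) l

intervalSum-+ : ∀ f o a b → intervalSum f o (a + b) ≡ intervalSum f o a + intervalSum f (o + a) b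
intervalSum-+ f o zero    b = cong (λ o′ → intervalSum f o′ b) (sym (+-identityʳ o))
intervalSum-+ f o (suc a) b = begin
  f o + intervalSum f (suc o) (a + b)
    ≡⟨ cong (f o +_) (intervalSum-+ f (suc o) a b) ⟩
  f o + (intervalSum f (suc o) a + intervalSum f (suc o + a) b)
    ≡⟨ sym (+-assoc (f o) _ _) ⟩
  f o + intervalSum f (suc o) a + intervalSum f (suc (o + a)) b
    ≡⟨ cong (λ o′ → f o + intervalSum f (suc o) a + intervalSum f o′ b) (sym (+-suc o a)) ⟩
  f o + intervalSum f (suc o) a + intervalSum f (o + suc a) b ∎
  where open ≡-Reasoning

intervalSum-++ : ∀ {X : Set} f o (xs ys : List X) →
  intervalSum f o (length (xs ++ ys)) ≡ intervalSum f o (length xs) + intervalSum f (o + length xs) (length ys)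
intervalSum-++ f o xs ys = trans (cong (intervalSum f o) (length-++ xs)) (intervalSum-+ f o (length xs) (length ys))

intervalSum-++₃ : ∀ {X : Set} f o (l m r : List X) →
  intervalSum f o (length (l ++ m ++ r)) ≡
  intervalSum f o (length l) + (intervalSum f (o + length l) (length m) + intervalSum f (o + length l + length m) (length r))
intervalSum-++₃ f o l m r =
  trans (intervalSum-++ f o l (m ++ r)) (cong (intervalSum f o (length l) +_) (intervalSum-++ f (o + length l) m r))

0<intervalSum⇒∃ : ∀ f o l → 1 ≤ intervalSum f o l → ∃[ i ] (o ≤ i × i < o + l × 1 ≤ f i)
0<intervalSum⇒∃ f o (suc l) h with f o in fo≡
... | suc _ = o , ≤-refl , subst (o <_) (sym (+-suc o l)) (s≤s (m≤m+n o l)) , subst (1 ≤_) (sym fo≡) (s≤s z≤n)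
... | zero with 0<intervalSum⇒∃ f (suc o) l h
...   | i , o<i , i<o+l , fi = i , <⇒≤ o<i , subst (i <_) (sym (+-suc o l)) i<o+l , fi

intervalSum≡0⇒≡0 : ∀ f o l i → intervalSum f o l ≡ 0 → o ≤ i → i < o + l → f i ≡ 0
intervalSum≡0⇒≡0 f o zero i _ o≤i i<o+0 =
  ⊥-elim (<⇒≱ i<o+0 (subst (_≤ i) (sym (+-identityʳ o)) o≤i))
intervalSum≡0⇒≡0 f o (suc l) i h o≤i i<o+l with m≤n⇒m<n∨m≡n o≤i
... | inj₂ refl = m+n≡0⇒m≡0 (f o) h
... | inj₁ o<i  = intervalSum≡0⇒≡0 f (suc o) l i (m+n≡0⇒n≡0 (f o) h) o<i (subst (i <_) (+-suc o l) i<o+l)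

-- Positions are 0-based, as in OccupiedByVX; indicator p j = 0 for j ≥ n.
indicator : ∀ {n} → Subset n → ℕ → ℕ
indicator []            _       = 0
indicator (_ ∷ p)       (suc j) = indicator p j
indicator (inside ∷ p)  zero    = 1
indicator (outside ∷ p) zero    = 0

marks : ∀ {n} → Subset n → ℕ → ℕ → ℕ
marks p = intervalSum (indicator p)

indicator≤1 : ∀ {n} (p : Subset n) j → indicator p j ≤ 1
indicator≤1 []            j       = z≤n
indicator≤1 (_ ∷ p)       (suc j) = indicator≤1 p j
indicator≤1 (inside ∷ p)  zero    = ≤-refl
indicator≤1 (outside ∷ p) zero    = z≤n

indicator-∈ : ∀ {n} (p : Subset n) (j : Fin n) → j ∈ p → indicator p (toℕ j) ≡ 1
indicator-∈ (inside ∷ p) zero    here      = refl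
indicator-∈ (_ ∷ p)      (suc j) (there q) = indicator-∈ p j q

0<indicator⇒∈ : ∀ {n} (p : Subset n) i → 1 ≤ indicator p i → ∃[ j ] (toℕ j ≡ i × j ∈ p)
0<indicator⇒∈ (inside ∷ p) zero    _ = zero , refl , here
0<indicator⇒∈ (_ ∷ p)      (suc i) h with 0<indicator⇒∈ p i h
... | j , refl , j∈p = suc j , refl , there j∈p

marks-∷ : ∀ {n} x (p : Subset n) o l → marks (x ∷ p) (suc o) l ≡ marks p o l
marks-∷ x p o zero    = refl
marks-∷ x p o (suc l) = cong (indicator p o +_) (marks-∷ x p (suc o) l)

∣p∣≡marks : ∀ {n} (p : Subset n) → ∣ p ∣ ≡ marks p 0 n
∣p∣≡marks []                    = refl
∣p∣≡marks {suc n} (inside ∷ p)  = cong suc (trans (∣p∣≡marks p) (sym (marks-∷ inside p 0 n)))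
∣p∣≡marks {suc n} (outside ∷ p) = trans (∣p∣≡marks p) (sym (marks-∷ outside p 0 n))

marked⇒∈ : ∀ {n} (p : Subset n) o l → 1 ≤ marks p o l →
  ∃[ j ] (j ∈ p × o ≤ toℕ j × toℕ j < o + l)
marked⇒∈ p o l h with 0<intervalSum⇒∃ (indicator p) o l h
... | i , o≤i , i<o+l , pi with 0<indicator⇒∈ p i pi
...   | j , refl , j∈p = j , j∈p , o≤i , i<o+l

unmarked⇒∉ : ∀ {n} (p : Subset n) o l (j : Fin n) → marks p o l ≡ 0 →
  o ≤ toℕ j → toℕ j < o + l → j ∉ p
unmarked⇒∉ p o l j h o≤j j<o+l j∈p =
  0≢1+n (trans (sym (intervalSum≡0⇒≡0 (indicator p) o l (toℕ j) h o≤j j<o+l)) (indicator-∈ p j j∈p))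

marked⇒occupied : ∀ {n} (D : Subset n) lu lv lw lx →
  1 ≤ marks D lu lv + marks D (lu + lv + lw) lx → ∃[ j ] (j ∈ D × OccupiedByVX lu lv lw lx (toℕ j))
marked⇒occupied D lu lv lw lx h with 1 ≤? marks D lu lv
... | yes inV with marked⇒∈ D lu lv inV
...   | j , j∈D , bounds = j , j∈D , inj₁ bounds
marked⇒occupied D lu lv lw lx h | no ¬inV
  with marked⇒∈ D (lu + lv + lw) lx (subst (λ a → 1 ≤ a + marks D (lu + lv + lw) lx) (n<1⇒n≡0 (≰⇒> ¬inV)) h)
... | j , j∈D , bounds = j , j∈D , inj₂ bounds

unmarked⇒¬occupied : ∀ {n} (E : Subset n) lu lv lw lx →
  marks E lu lv ≡ 0 → marks E (lu + lv + lw) lx ≡ 0 →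
  ∀ (j : Fin n) → OccupiedByVX lu lv lw lx (toℕ j) → j ∉ E
unmarked⇒¬occupied E lu lv lw lx noV _   j (inj₁ (a , b)) = unmarked⇒∉ E lu lv j noV a b
unmarked⇒¬occupied E lu lv lw lx _   noX j (inj₂ (a , b)) = unmarked⇒∉ E (lu + lv + lw) lx j noX a b

∣q∣<∣p∣⇒∃∈p∉q : ∀ {n} (p q : Subset n) → ∣ q ∣ < ∣ p ∣ → ∃[ j ] (j ∈ p × j ∉ q)
∣q∣<∣p∣⇒∃∈p∉q p q h with any? (λ j → j ∈? p ×-dec ¬? (j ∈? q))
... | yes found = found
... | no  none  = ⊥-elim (<⇒≱ h (p⊆q⇒∣p∣≤∣q∣ p⊆q))
  where
  p⊆q : ∀ {j} → j ∈ p → j ∈ q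
  p⊆q {j} j∈p with j ∈? q
  ... | yes j∈q = j∈q
  ... | no  j∉q = ⊥-elim (none (j , j∈p , j∉q))

module Thresholds (c N : ℕ) where

  b : ℕ
  b = suc c

  bᴺ : ℕ
  bᴺ = b ^ N

  growth : ℕ → ℕ
  growth f = f * (c * bᴺ)

  K : ℕ
  K = bᴺ + growth N

  S : ℕ
  S = b * K

  -- The constants are dictated by sum-childThreshold≤threshold; b bounds the number of children.
  threshold : ℕ → ℕ → ℕ
  threshold f zero    = b ^ f
  threshold f (suc e) = growth f + S * suc (2 * e)

  1≤S : 1 ≤ S
  1≤S = ≤-trans (m^n>0 b N) (≤-trans (m≤m+n bᴺ (growth N)) (m≤m+n K (c * K)))

  1≤threshold : ∀ f e → 1 ≤ threshold f e
  1≤threshold f zero    = m^n>0 b f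
  1≤threshold f (suc e) = ≤-trans 1≤S (≤-trans (m≤m*n S (suc (2 * e))) (m≤n+m _ (growth f)))

  -- Opaque, so that visitChild's with-abstraction over e′ ≟ e does not reach inside it.
  opaque
    -- A child carrying all e excluded marks of its parent still competes for
    -- the same pump, with one nonterminal fewer; any other child starts afresh.
    childThreshold : ℕ → ℕ → ℕ → ℕ
    childThreshold f e e′ with e′ ≟ e
    ... | yes _ = threshold (f ∸ 1) e′
    ... | no  _ = threshold N e′

    childThreshold-≡ : ∀ f e e′ → e′ ≡ e → childThreshold f e e′ ≡ threshold (f ∸ 1) e′
    childThreshold-≡ f e e′ e′≡e with e′ ≟ e
    ... | yes _   = refl
    ... | no e′≢e = ⊥-elim (e′≢e e′≡e)

    childThreshold-≢ : ∀ f e e′ → e′ ≢ e → childThreshold f e e′ ≡ threshold N e′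
    childThreshold-≢ f e e′ e′≢e with e′ ≟ e
    ... | yes e′≡e = ⊥-elim (e′≢e e′≡e)
    ... | no _     = refl

    1≤childThreshold : ∀ f e e′ → 1 ≤ childThreshold f e e′
    1≤childThreshold f e e′ with e′ ≟ e
    ... | yes _ = 1≤threshold (f ∸ 1) e′
    ... | no  _ = 1≤threshold N e′

  threshold-monoˡ : ∀ {f g} e → f ≤ g → threshold f e ≤ threshold g e
  threshold-monoˡ zero    f≤g = ^-monoʳ-≤ b f≤g
  threshold-monoˡ (suc e) f≤g = +-monoˡ-≤ _ (*-monoˡ-≤ (c * bᴺ) f≤g)

  sum-map-zeros : ∀ (g : ℕ → ℕ) es → sum es ≡ 0 → sum (map g es) ≡ length es * g 0
  sum-map-zeros g []       _ = refl
  sum-map-zeros g (e ∷ es) h rewrite m+n≡0⇒m≡0 e h =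
    cong (g 0 +_) (sum-map-zeros g es (m+n≡0⇒n≡0 e h))

  ∈⇒≤sum : ∀ {k} es → k ∈ₗ es → k ≤ sum es
  ∈⇒≤sum (e ∷ es) (here refl) = m≤m+n e (sum es)
  ∈⇒≤sum (e ∷ es) (there k∈)  = ≤-trans (∈⇒≤sum es k∈) (m≤n+m (sum es) e)

  sum-childThreshold-unexcluded : ∀ f es → sum es ≡ 0 → length es ≤ b →
    sum (map (childThreshold (suc f) 0) es) ≤ threshold (suc f) 0
  sum-childThreshold-unexcluded f es es≡0 len≤b = begin
    sum (map (childThreshold (suc f) 0) es) ≡⟨ sum-map-zeros _ es es≡0 ⟩
    length es * childThreshold (suc f) 0 0  ≡⟨ cong (length es *_) (childThreshold-≡ (suc f) 0 0 refl) ⟩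
    length es * b ^ f                       ≤⟨ *-monoˡ-≤ (b ^ f) len≤b ⟩
    b * b ^ f                               ∎
    where open ≤-Reasoning

  sum-childThreshold-concentrated : ∀ f e es → e ∈ₗ es → sum es ≡ e → 1 ≤ e →
    sum (map (childThreshold f e) es) + bᴺ ≡ threshold (f ∸ 1) e + length es * bᴺ
  sum-childThreshold-concentrated f e (e ∷ es) (here refl) sum≡e 1≤e = begin
    childThreshold f e e + sum (map (childThreshold f e) es) + bᴺ
      ≡⟨ cong₂ (λ t r → t + r + bᴺ) (childThreshold-≡ f e e refl) (sum-map-zeros _ es rest≡0) ⟩
    threshold (f ∸ 1) e + length es * childThreshold f e 0 + bᴺ
      ≡⟨ cong (λ t → threshold (f ∸ 1) e + length es * t + bᴺ) (childThreshold-≢ f e 0 (<⇒≢ 1≤e)) ⟩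
    threshold (f ∸ 1) e + length es * bᴺ + bᴺ
      ≡⟨ trans (+-assoc (threshold (f ∸ 1) e) _ bᴺ) (cong (threshold (f ∸ 1) e +_) (+-comm _ bᴺ)) ⟩
    threshold (f ∸ 1) e + (bᴺ + length es * bᴺ) ∎
    where
    open ≡-Reasoning
    rest≡0 : sum es ≡ 0
    rest≡0 = +-cancelˡ-≡ e _ _ (trans sum≡e (sym (+-identityʳ e)))
  sum-childThreshold-concentrated f e (e′ ∷ es) (there e∈es) sum≡e 1≤e = begin
    childThreshold f e e′ + sum (map (childThreshold f e) es) + bᴺ
      ≡⟨ +-assoc (childThreshold f e e′) _ bᴺ ⟩
    childThreshold f e e′ + (sum (map (childThreshold f e) es) + bᴺ)
      ≡⟨ cong₂ _+_ head≡bᴺ (sum-childThreshold-concentrated f e es e∈es rest≡e 1≤e) ⟩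
    bᴺ + (threshold (f ∸ 1) e + length es * bᴺ)
      ≡⟨ x∙yz≈y∙xz bᴺ (threshold (f ∸ 1) e) _ ⟩
    threshold (f ∸ 1) e + (bᴺ + length es * bᴺ) ∎
    where
    open ≡-Reasoning
    e′≡0 : e′ ≡ 0
    e′≡0 = n≤0⇒n≡0 (+-cancelʳ-≤ (sum es) e′ 0 (subst (_≤ sum es) (sym sum≡e) (∈⇒≤sum es e∈es)))
    rest≡e : sum es ≡ e
    rest≡e = trans (sym (cong (_+ sum es) e′≡0)) sum≡e
    head≡bᴺ : childThreshold f e e′ ≡ bᴺ
    head≡bᴺ rewrite e′≡0 = childThreshold-≢ f e 0 (<⇒≢ 1≤e)

  nonzeros : List ℕ → ℕ
  nonzeros []           = 0
  nonzeros (zero  ∷ es) = nonzeros es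
  nonzeros (suc _ ∷ es) = suc (nonzeros es)

  nonzeros≡0⇒sum≡0 : ∀ es → nonzeros es ≡ 0 → sum es ≡ 0
  nonzeros≡0⇒sum≡0 []           _ = refl
  nonzeros≡0⇒sum≡0 (zero  ∷ es) h = nonzeros≡0⇒sum≡0 es h

  nonzeros≤1⇒sum≡0⊎sum∈ : ∀ es → nonzeros es ≤ 1 → sum es ≡ 0 ⊎ sum es ∈ₗ es
  nonzeros≤1⇒sum≡0⊎sum∈ []           _ = inj₁ refl
  nonzeros≤1⇒sum≡0⊎sum∈ (zero  ∷ es) h with nonzeros≤1⇒sum≡0⊎sum∈ es h
  ... | inj₁ sum≡0 = inj₁ sum≡0
  ... | inj₂ sum∈  = inj₂ (there sum∈)
  nonzeros≤1⇒sum≡0⊎sum∈ (suc e ∷ es) (s≤s h) =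
    inj₂ (here (trans (cong (suc e +_) (nonzeros≡0⇒sum≡0 es (n≤0⇒n≡0 h))) (+-identityʳ (suc e))))

  2≤nonzeros : ∀ es → 1 ≤ sum es → sum es ∉ₗ es → 2 ≤ nonzeros es
  2≤nonzeros es 1≤sum sum∉ with 2 ≤? nonzeros es
  ... | yes 2≤ = 2≤
  ... | no  2≰ with nonzeros≤1⇒sum≡0⊎sum∈ es (≤-pred (≰⇒> 2≰))
  ...   | inj₁ sum≡0 = ⊥-elim (<⇒≢ 1≤sum (sym sum≡0))
  ...   | inj₂ sum∈  = ⊥-elim (sum∉ sum∈)

  sum-threshold+nonzeros≤ : ∀ es →
    sum (map (threshold N) es) + S * nonzeros es ≤ length es * K + 2 * S * sum es
  sum-threshold+nonzeros≤ [] = ≤-reflexive (trans (*-zeroʳ S) (sym (*-zeroʳ (2 * S))))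
  sum-threshold+nonzeros≤ (zero ∷ es) = begin
    bᴺ + total + S * nonzeros es         ≡⟨ +-assoc bᴺ total _ ⟩
    bᴺ + (total + S * nonzeros es)       ≤⟨ +-mono-≤ (m≤m+n bᴺ (growth N)) (sum-threshold+nonzeros≤ es) ⟩
    K + (length es * K + 2 * S * sum es) ≡⟨ sym (+-assoc K _ _) ⟩
    K + length es * K + 2 * S * sum es   ∎
    where
    open ≤-Reasoning
    total : ℕ
    total = sum (map (threshold N) es)
  sum-threshold+nonzeros≤ (suc e ∷ es) = begin
    threshold N (suc e) + total + S * suc (nonzeros es)
      ≡⟨ regroupˡ (growth N) S e total (nonzeros es) ⟩
    (growth N + 2 * S * suc e) + (total + S * nonzeros es)
      ≤⟨ +-mono-≤ (+-monoˡ-≤ _ (m≤n+m (growth N) bᴺ)) (sum-threshold+nonzeros≤ es) ⟩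
    (K + 2 * S * suc e) + (length es * K + 2 * S * sum es)
      ≡⟨ regroupʳ K S e (length es) (sum es) ⟩
    suc (length es) * K + 2 * S * (suc e + sum es) ∎
    where
    open ≤-Reasoning
    total : ℕ
    total = sum (map (threshold N) es)
    regroupˡ : ∀ g s e t n → g + s * suc (2 * e) + t + s * suc n ≡ (g + 2 * s * suc e) + (t + s * n)
    regroupˡ = solve-∀
    regroupʳ : ∀ k s e l t → (k + 2 * s * suc e) + (l * k + 2 * s * t) ≡ suc l * k + 2 * s * (suc e + t)
    regroupʳ = solve-∀

  sum-threshold-spread : ∀ e es → sum es ≡ suc e → 2 ≤ nonzeros es → length es ≤ b →
    sum (map (threshold N) es) ≤ S * suc (2 * e)
  sum-threshold-spread e es sum≡ 2≤nz len≤b = +-cancelʳ-≤ (S * 2) _ _ (begin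
    total + S * 2                  ≤⟨ +-monoʳ-≤ total (*-monoʳ-≤ S 2≤nz) ⟩
    total + S * nonzeros es        ≤⟨ sum-threshold+nonzeros≤ es ⟩
    length es * K + 2 * S * sum es ≤⟨ +-monoˡ-≤ _ (*-monoˡ-≤ K len≤b) ⟩
    S + 2 * S * sum es             ≡⟨ cong (λ t → S + 2 * S * t) sum≡ ⟩
    S + 2 * S * suc e              ≡⟨ regroup S e ⟩
    S * suc (2 * e) + S * 2        ∎)
    where
    open ≤-Reasoning
    total : ℕ
    total = sum (map (threshold N) es)
    regroup : ∀ s e → s + 2 * s * suc e ≡ s * suc (2 * e) + s * 2
    regroup = solve-∀

  sum-childThreshold-∉ : ∀ f e es → e ∉ₗ es →
    sum (map (childThreshold f e) es) ≡ sum (map (threshold N) es)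
  sum-childThreshold-∉ f e []        _   = refl
  sum-childThreshold-∉ f e (e′ ∷ es) e∉ =
    cong₂ _+_ (childThreshold-≢ f e e′ (λ e′≡e → e∉ (here (sym e′≡e))))
              (sum-childThreshold-∉ f e es (λ e∈ → e∉ (there e∈)))

  sum-childThreshold≤threshold : ∀ f e es → 1 ≤ f → sum es ≡ e → length es ≤ b →
    sum (map (childThreshold f e) es) ≤ threshold f e
  sum-childThreshold≤threshold (suc f) zero    es _ es≡0 len≤b =
    sum-childThreshold-unexcluded f es es≡0 len≤b
  sum-childThreshold≤threshold (suc f) (suc e) es _ sum≡ len≤b with suc e ∈ₗ? es
  ... | yes e∈ = +-cancelʳ-≤ bᴺ _ _ (begin
    total + bᴺ                           ≡⟨ sum-childThreshold-concentrated (suc f) (suc e) es e∈ sum≡ (s≤s z≤n) ⟩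
    threshold f (suc e) + length es * bᴺ ≤⟨ +-monoʳ-≤ _ (*-monoˡ-≤ bᴺ len≤b) ⟩
    threshold f (suc e) + b * bᴺ         ≡⟨ regroup (growth f) (S * suc (2 * e)) bᴺ (c * bᴺ) ⟩
    threshold (suc f) (suc e) + bᴺ       ∎)
    where
    open ≤-Reasoning
    total : ℕ
    total = sum (map (childThreshold (suc f) (suc e)) es)
    regroup : ∀ g x z cz → g + x + (z + cz) ≡ cz + g + x + z
    regroup = solve-∀
  ... | no e∉ = begin
    sum (map (childThreshold (suc f) (suc e)) es) ≡⟨ sum-childThreshold-∉ (suc f) (suc e) es e∉ ⟩
    sum (map (threshold N) es)                    ≤⟨ sum-threshold-spread e es sum≡ 2≤nz len≤b ⟩
    S * suc (2 * e)                               ≤⟨ m≤n+m _ (growth (suc f)) ⟩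
    threshold (suc f) (suc e)                     ∎
    where
    open ≤-Reasoning
    2≤nz : 2 ≤ nonzeros es
    2≤nz = 2≤nonzeros es (subst (1 ≤_) (sym sum≡) (s≤s z≤n)) (subst (_∉ₗ es) (sym sum≡) e∉)

  threshold≤linear : ∀ e → threshold N e ≤ (K + 2 * S) * suc e
  threshold≤linear zero = begin
    bᴺ                      ≤⟨ m≤m+n bᴺ (growth N + 2 * S) ⟩
    bᴺ + (growth N + 2 * S) ≡⟨ sym (trans (*-identityʳ _) (+-assoc bᴺ _ _)) ⟩
    (K + 2 * S) * 1         ∎
    where open ≤-Reasoning
  threshold≤linear (suc e) = begin
    growth N + S * suc (2 * e)            ≤⟨ m≤m+n _ _ ⟩
    growth N + S * suc (2 * e) + slack    ≡⟨ expand bᴺ (growth N) S e ⟩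
    (bᴺ + growth N + 2 * S) * suc (suc e) ∎
    where
    open ≤-Reasoning
    slack : ℕ
    slack = bᴺ * (e + 2) + growth N * (e + 1) + 3 * S
    expand : ∀ z g s e → g + s * suc (2 * e) + (z * (e + 2) + g * (e + 1) + 3 * s) ≡ (z + g + 2 * s) * suc (suc e)
    expand = solve-∀

module Contexts {s : ℕ} (G : CFG s) where

  NT : Set
  NT = Fin (N G)

  DerivesSeq-++ : ∀ {α β l r} → DerivesSeq G α l → DerivesSeq G β r → DerivesSeq G (α ++ β) (l ++ r)
  DerivesSeq-++ done         d′ = d′
  DerivesSeq-++ (term d)     d′ = term (DerivesSeq-++ d d′)
  DerivesSeq-++ {r = r} (nont {w₁ = w₁} {w₂ = w₂} d ds) d′ =
    subst (DerivesSeq G _) (sym (++-assoc w₁ w₂ r)) (nont d (DerivesSeq-++ ds d′))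

  length-++₃ : ∀ (l m r : Word s) → length (l ++ m ++ r) ≡ length l + (length m + length r)
  length-++₃ l m r = trans (length-++ l) (cong (length l +_) (length-++ m))

  length-++₅ : ∀ (u v w x y : Word s) →
    length (u ++ v ++ w ++ x ++ y) ≡ length u + length v + length w + length x + length y
  length-++₅ u v w x y = begin
    length (u ++ v ++ w ++ x ++ y)                             ≡⟨ length-++ u ⟩
    length u + length (v ++ w ++ x ++ y)                       ≡⟨ cong (length u +_) (length-++ v) ⟩
    length u + (length v + length (w ++ x ++ y))               ≡⟨ cong (λ t → length u + (length v + t)) (length-++₃ w x y) ⟩
    length u + (length v + (length w + (length x + length y))) ≡⟨ reassoc (length u) (length v) (length w) _ _ ⟩
    length u + length v + length w + length x + length y       ∎
    where
    open ≡-Reasoning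
    reassoc : ∀ a b c d e → a + (b + (c + (d + e))) ≡ a + b + c + d + e
    reassoc = solve-∀

  -- Context A B v x is a derivation A ⇒* v B x: a parse tree of A with one open leaf B.
  data Context : NT → NT → Word s → Word s → Set where
    hole : ∀ {A} → Context A A [] []
    step : ∀ {A B C rhs α β l r v x} → (A , rhs) ∈ₗ rules G → rhs ≡ α ++ inj₁ C ∷ β →
           DerivesSeq G α l → DerivesSeq G β r → Context C B v x → Context A B (l ++ v) (x ++ r)

  single : ∀ {A C rhs α β l r} → (A , rhs) ∈ₗ rules G → rhs ≡ α ++ inj₁ C ∷ β →
           DerivesSeq G α l → DerivesSeq G β r → Context A C l r
  single {l = l} A→rhs rhs≡ dα dβ =
    subst (λ l′ → Context _ _ l′ _) (++-identityʳ l) (step A→rhs rhs≡ dα dβ hole)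

  compose : ∀ {A B C v x v′ x′} → Context A B v x → Context B C v′ x′ → Context A C (v ++ v′) (x′ ++ x)
  compose {x′ = x′} hole c = subst (Context _ _ _) (sym (++-identityʳ x′)) c
  compose {v′ = v′} {x′ = x′} (step {l = l} {r = r} {v = v} {x = x} A→rhs rhs≡ dα dβ c) c′ =
    subst₂ (Context _ _) (sym (++-assoc l v v′)) (++-assoc x′ x r) (step A→rhs rhs≡ dα dβ (compose c c′))

  plug : ∀ {A B v x w} → Context A B v x → Derives G B w → Derives G A (v ++ w ++ x)
  plug {w = w} hole d = subst (Derives G _) (sym (++-identityʳ w)) d
  plug {w = w} (step {l = l} {r = r} {v = v} {x = x} A→rhs rhs≡ dα dβ c) d =
    rule A→rhs (subst₂ (DerivesSeq G) (sym rhs≡) reassoc (DerivesSeq-++ dα (nont (plug c d) dβ)))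
    where
    open ≡-Reasoning
    reassoc : l ++ (v ++ w ++ x) ++ r ≡ (l ++ v) ++ w ++ x ++ r
    reassoc = begin
      l ++ (v ++ w ++ x) ++ r ≡⟨ cong (l ++_) (++-assoc v (w ++ x) r) ⟩
      l ++ v ++ (w ++ x) ++ r ≡⟨ cong (λ q → l ++ v ++ q) (++-assoc w x r) ⟩
      l ++ v ++ w ++ x ++ r   ≡⟨ sym (++-assoc l v _) ⟩
      (l ++ v) ++ w ++ x ++ r ∎

  concatMap-∷ʳ : ∀ {A : Set} (f : A → Word s) xs y → concatMap f (xs ++ [ y ]) ≡ concatMap f xs ++ f y
  concatMap-∷ʳ f xs y = begin
    concat (map f (xs ++ [ y ]))  ≡⟨ cong concat (map-++ f xs [ y ]) ⟩
    concat (map f xs ++ [ f y ])  ≡⟨ sym (concat-++ (map f xs) [ f y ]) ⟩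
    concatMap f xs ++ (f y ++ []) ≡⟨ cong (concatMap f xs ++_) (++-identityʳ (f y)) ⟩
    concatMap f xs ++ f y         ∎
    where open ≡-Reasoning

  iterate : ∀ {k A} (v x : Fin k → Word s) → (∀ i → Context A A (v i) (x i)) → (is : List (Fin k)) →
            Context A A (concatMap v is) (concatMap x (reverse is))
  iterate v x c []       = hole
  iterate v x c (i ∷ is) = subst (Context _ _ _) x-order (compose (c i) (iterate v x c is))
    where
    x-order : concatMap x (reverse is) ++ x i ≡ concatMap x (reverse (i ∷ is))
    x-order = sym (trans (cong (concatMap x) (unfold-reverse i is)) (concatMap-∷ʳ x (reverse is) i))

  pumped : ∀ {k A B} (u v w x y : Fin k → Word s) → (∀ i → Context B A (u i) (y i)) →
    (∀ i → Context A A (v i) (x i)) → (∀ i → Derives G A (w i)) →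
    ∀ i₀ is j → Derives G B (u i₀ ++ concatMap v is ++ w j ++ concatMap x (reverse is) ++ y i₀)
  pumped u v w x y outer loop core i₀ is j =
    subst (Derives G _) reassoc (plug (outer i₀) (plug (iterate v x loop is) (core j)))
    where
    V X : Word s
    V = concatMap v is
    X = concatMap x (reverse is)
    reassoc : u i₀ ++ (V ++ w j ++ X) ++ y i₀ ≡ u i₀ ++ V ++ w j ++ X ++ y i₀
    reassoc = cong (u i₀ ++_) (trans (++-assoc V _ (y i₀)) (cong (V ++_) (++-assoc (w j) X (y i₀))))

  maxRhs : ℕ
  maxRhs = foldr (λ r m → length (proj₂ r) ⊔ m) 0 (rules G)

  length-rhs≤maxRhs : ∀ {A rhs} → (A , rhs) ∈ₗ rules G → length rhs ≤ maxRhs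
  length-rhs≤maxRhs = go (rules G)
    where
    go : ∀ rs {A rhs} → (A , rhs) ∈ₗ rs → length rhs ≤ foldr (λ r m → length (proj₂ r) ⊔ m) 0 rs
    go (r ∷ rs) (here refl) = m≤m⊔n _ _
    go (r ∷ rs) (there A→rhs) = ≤-trans (go rs A→rhs) (m≤n⊔m _ _)

-- Descending a parse tree to a pump

module Descent {s : ℕ} (G : CFG s) {n : ℕ} (D E : Subset n) (z : Word s) where

  open Contexts G
  open Thresholds maxRhs (N G)

  record Pump : Set where
    field
      A : NT
      u v w x y : Word s
      prefix : Context (start G) A u y
      loop : Context A A v x
      core : Derives G A w
      splits : z ≡ u ++ v ++ w ++ x ++ y
      distinguished : 1 ≤ marks D (length u) (length v) + marks D (length u + length v + length w) (length x)
      excludedᵛ : marks E (length u) (length v) ≡ 0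
      excludedˣ : marks E (length u + length v + length w) (length x) ≡ 0

  record OpenLoop (B A : NT) (pre w post : Word s) : Set where
    field
      u v x y : Word s
      prefix : Context (start G) B u y
      loop : Context B A v x
      pre≡ : u ++ v ≡ pre
      post≡ : x ++ y ≡ post
      distinguished : 1 ≤ marks D (length u) (length v) + marks D (length pre + length w) (length x)
      excludedᵛ : marks E (length u) (length v) ≡ 0
      excludedˣ : marks E (length pre + length w) (length x) ≡ 0

  OpenLoops : Subset (N G) → NT → Word s → Word s → Word s → Set
  OpenLoops U A pre w post = ∀ B → B ∉ U → OpenLoop B A pre w post

  OpenLoop-close : ∀ {A pre w post} → OpenLoop A A pre w post → Derives G A w → pre ++ w ++ post ≡ z → Pump
  OpenLoop-close {A} {pre} {w} {post} ol d splits′ = record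
    { A = A ; u = u ; v = v ; w = w ; x = x ; y = y
    ; prefix = prefix ; loop = loop ; core = d
    ; splits = sym z≡
    ; distinguished = subst (λ o → 1 ≤ marks D (length u) (length v) + marks D (o + length w) (length x)) ∣pre∣ distinguished
    ; excludedᵛ = excludedᵛ
    ; excludedˣ = subst (λ o → marks E (o + length w) (length x) ≡ 0) ∣pre∣ excludedˣ
    }
    where
    open OpenLoop ol
    ∣pre∣ : length pre ≡ length u + length v
    ∣pre∣ = trans (cong length (sym pre≡)) (length-++ u)
    z≡ : u ++ v ++ w ++ x ++ y ≡ z
    z≡ = begin
      u ++ v ++ w ++ x ++ y   ≡⟨ sym (++-assoc u v _) ⟩
      (u ++ v) ++ w ++ x ++ y ≡⟨ cong₂ (λ p q → p ++ w ++ q) pre≡ post≡ ⟩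
      pre ++ w ++ post        ≡⟨ splits′ ⟩
      z                       ∎
      where open ≡-Reasoning

  OpenLoop-extend : ∀ {B A C pre w post l wc w₂} → w ≡ l ++ wc ++ w₂ → Context A C l w₂ →
    marks E (length pre) (length l) ≡ 0 → marks E (length pre + length l + length wc) (length w₂) ≡ 0 →
    OpenLoop B A pre w post → OpenLoop B C (pre ++ l) wc (w₂ ++ post)
  OpenLoop-extend {pre = pre} {w} {post} {l} {wc} {w₂} w≡ c noEˡ noEʳ ol = record
    { u = u ; v = v ++ l ; x = w₂ ++ x ; y = y
    ; prefix = prefix ; loop = compose loop c
    ; pre≡ = trans (sym (++-assoc u v l)) (cong (_++ l) pre≡)
    ; post≡ = trans (++-assoc w₂ x y) (cong (w₂ ++_) post≡)
    ; distinguished = ≤-trans distinguished (+-mono-≤ markedᵛ markedˣ)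
    ; excludedᵛ = trans (splitᵛ E) (cong₂ _+_ excludedᵛ noEˡ)
    ; excludedˣ = trans (splitˣ E) (cong₂ _+_ (subst (λ o → marks E o (length w₂) ≡ 0) (sym o′≡) noEʳ) excludedˣ)
    }
    where
    open OpenLoop ol
    o′ : ℕ
    o′ = length (pre ++ l) + length wc
    o′≡ : o′ ≡ length pre + length l + length wc
    o′≡ = cong (_+ length wc) (length-++ pre)
    o′+∣w₂∣ : o′ + length w₂ ≡ length pre + length w
    o′+∣w₂∣ = begin
      o′ + length w₂                                    ≡⟨ cong (_+ length w₂) o′≡ ⟩
      length pre + length l + length wc + length w₂     ≡⟨ +-assoc (length pre + length l) _ _ ⟩
      length pre + length l + (length wc + length w₂)   ≡⟨ +-assoc (length pre) _ _ ⟩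
      length pre + (length l + (length wc + length w₂)) ≡⟨ cong (length pre +_) (sym (length-++₃ l wc w₂)) ⟩
      length pre + length (l ++ wc ++ w₂)               ≡⟨ cong (λ w′ → length pre + length w′) (sym w≡) ⟩
      length pre + length w                             ∎
      where open ≡-Reasoning
    ∣u∣+∣v∣ : length u + length v ≡ length pre
    ∣u∣+∣v∣ = trans (sym (length-++ u)) (cong length pre≡)
    splitᵛ : ∀ P → marks P (length u) (length (v ++ l)) ≡ marks P (length u) (length v) + marks P (length pre) (length l)
    splitᵛ P = trans (intervalSum-++ _ (length u) v l)
                     (cong (λ o → marks P (length u) (length v) + marks P o (length l)) ∣u∣+∣v∣)
    splitˣ : ∀ P → marks P o′ (length (w₂ ++ x)) ≡ marks P o′ (length w₂) + marks P (length pre + length w) (length x)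
    splitˣ P = trans (intervalSum-++ _ o′ w₂ x)
                     (cong (λ o → marks P o′ (length w₂) + marks P o (length x)) o′+∣w₂∣)
    markedᵛ : marks D (length u) (length v) ≤ marks D (length u) (length (v ++ l))
    markedᵛ = subst (marks D (length u) (length v) ≤_) (sym (splitᵛ D)) (m≤m+n _ (marks D (length pre) (length l)))
    markedˣ : marks D (length pre + length w) (length x) ≤ marks D o′ (length (w₂ ++ x))
    markedˣ = subst (marks D (length pre + length w) (length x) ≤_) (sym (splitˣ D)) (m≤n+m _ (marks D o′ (length w₂)))

  OpenLoop-new : ∀ {A C pre post l wc w₂} → Context (start G) A pre post → Context A C l w₂ →
    marks E (length pre) (length l) ≡ 0 → marks E (length pre + length l + length wc) (length w₂) ≡ 0 →
    1 ≤ marks D (length pre) (length l) + marks D (length pre + length l + length wc) (length w₂) →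
    OpenLoop A C (pre ++ l) wc (w₂ ++ post)
  OpenLoop-new {pre = pre} {post} {l} {wc} {w₂} ctx c noEˡ noEʳ marked = record
    { u = pre ; v = l ; x = w₂ ; y = post ; prefix = ctx ; loop = c ; pre≡ = refl ; post≡ = refl
    ; distinguished = subst (λ o → 1 ≤ marks D (length pre) (length l) + marks D (o + length wc) (length w₂)) ∣pre++l∣ marked
    ; excludedᵛ = noEˡ
    ; excludedˣ = subst (λ o → marks E (o + length wc) (length w₂) ≡ 0) ∣pre++l∣ noEʳ
    }
    where
    ∣pre++l∣ : length pre + length l ≡ length (pre ++ l)
    ∣pre++l∣ = sym (length-++ pre)

  record Node (A : NT) (w : Word s) : Set where
    field
      pre post : Word s
      splits : pre ++ w ++ post ≡ z
      prefix : Context (start G) A pre post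
      unused : Subset (N G)
      loops : OpenLoops unused A pre w post
      abundant : threshold ∣ unused ∣ (marks E (length pre) (length w)) < marks D (length pre) (length w)

  childNode : ∀ {A C w l wc w₂} (nd : Node A w) → w ≡ l ++ wc ++ w₂ → Context A C l w₂ →
    let open Node nd in (U : Subset (N G)) → OpenLoops U C (pre ++ l) wc (w₂ ++ post) →
    threshold ∣ U ∣ (marks E (length pre + length l) (length wc)) < marks D (length pre + length l) (length wc) →
    Node C wc
  childNode {w = w} {l} {wc} {w₂} nd w≡ c U loops′ abundant′ = record
    { pre = pre ++ l ; post = w₂ ++ post ; splits = splits′ ; prefix = compose prefix c
    ; unused = U ; loops = loops′
    ; abundant = subst (λ o → threshold ∣ U ∣ (marks E o (length wc)) < marks D o (length wc)) (sym (length-++ pre)) abundant′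
    }
    where
    open Node nd
    splits′ : (pre ++ l) ++ wc ++ w₂ ++ post ≡ z
    splits′ = begin
      (pre ++ l) ++ wc ++ w₂ ++ post ≡⟨ ++-assoc pre l _ ⟩
      pre ++ l ++ wc ++ w₂ ++ post   ≡⟨ cong (λ q → pre ++ l ++ q) (sym (++-assoc wc w₂ post)) ⟩
      pre ++ l ++ (wc ++ w₂) ++ post ≡⟨ cong (pre ++_) (sym (++-assoc l (wc ++ w₂) post)) ⟩
      pre ++ (l ++ wc ++ w₂) ++ post ≡⟨ cong (λ q → pre ++ q ++ post) (sym w≡) ⟩
      pre ++ w ++ post               ≡⟨ splits ⟩
      z                              ∎
      where open ≡-Reasoning

  childExcluded : ∀ {β wr} → DerivesSeq G β wr → ℕ → List ℕ
  childExcluded done                     o = []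
  childExcluded (term d)                 o = marks E o 1 ∷ childExcluded d (suc o)
  childExcluded (nont {w₁ = w₁} d ds)    o = marks E o (length w₁) ∷ childExcluded ds (o + length w₁)

  length-childExcluded : ∀ {β wr} (ds : DerivesSeq G β wr) o → length (childExcluded ds o) ≡ length β
  length-childExcluded done        o = refl
  length-childExcluded (term d)    o = cong suc (length-childExcluded d (suc o))
  length-childExcluded (nont d ds) o = cong suc (length-childExcluded ds _)

  sum-childExcluded : ∀ {β wr} (ds : DerivesSeq G β wr) o → sum (childExcluded ds o) ≡ marks E o (length wr)
  sum-childExcluded done o = refl
  sum-childExcluded (term d) o =
    cong₂ _+_ (+-identityʳ (indicator E o)) (sum-childExcluded d (suc o))
  sum-childExcluded (nont {w₁ = w₁} {w₂ = w₂} d ds) o =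
    trans (cong (marks E o (length w₁) +_) (sum-childExcluded ds (o + length w₁))) (sym (intervalSum-++ _ o w₁ w₂))

  Surplus : ∀ {A w β wr} → Node A w → Word s → DerivesSeq G β wr → Set
  Surplus {w = w} {wr = wr} nd l ds =
    sum (map (childThreshold ∣ unused ∣ (marks E (length pre) (length w))) (childExcluded ds (length pre + length l)))
      < marks D (length pre + length l) (length wr)
    where open Node nd

  initialSurplus : ∀ {A w rhs} (nd : Node A w) → A ∈ Node.unused nd → (A , rhs) ∈ₗ rules G →
    (ds : DerivesSeq G rhs w) → Surplus nd [] ds
  initialSurplus {w = w} {rhs} nd A∈ A→rhs ds rewrite +-identityʳ (length (Node.pre nd)) = ≤-<-trans
    (sum-childThreshold≤threshold ∣ unused ∣ _ (childExcluded ds (length pre)) 1≤∣unused∣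
      (sum-childExcluded ds (length pre)) fewChildren)
    abundant
    where
    open Node nd
    1≤∣unused∣ : 1 ≤ ∣ unused ∣
    1≤∣unused∣ = ≤-trans (s≤s z≤n) (x∈p⇒∣p-x∣<∣p∣ A∈)
    fewChildren : length (childExcluded ds (length pre)) ≤ suc maxRhs
    fewChildren = begin
      length (childExcluded ds (length pre)) ≡⟨ length-childExcluded ds (length pre) ⟩
      length rhs                             ≤⟨ length-rhs≤maxRhs A→rhs ⟩
      maxRhs                                 ≤⟨ n≤1+n maxRhs ⟩
      suc maxRhs                             ∎
      where open ≤-Reasoning

  marks-split : ∀ (P : Subset n) {w} o (l wc w₂ : Word s) → w ≡ l ++ wc ++ w₂ → marks P o (length w) ≡
    marks P o (length l) + (marks P (o + length l) (length wc) + marks P (o + length l + length wc) (length w₂))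
  marks-split P o l wc w₂ refl = intervalSum-++₃ (indicator P) o l wc w₂

  unexcluded-outside : ∀ {w} o (l wc w₂ : Word s) → w ≡ l ++ wc ++ w₂ →
    marks E (o + length l) (length wc) ≡ marks E o (length w) →
    marks E o (length l) ≡ 0 × marks E (o + length l + length wc) (length w₂) ≡ 0
  unexcluded-outside o l wc w₂ w≡ ec≡e =
    m+[n+o]≡n⇒m≡0×o≡0 _ _ _ (trans (sym (marks-split E o l wc w₂ w≡)) (sym ec≡e))

  distinguished-outside : ∀ {w} o (l wc w₂ : Word s) → w ≡ l ++ wc ++ w₂ →
    marks D (o + length l) (length wc) ≢ marks D o (length w) →
    1 ≤ marks D o (length l) + marks D (o + length l + length wc) (length w₂)
  distinguished-outside o l wc w₂ w≡ dc≢d =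
    n≢m+[n+o]⇒1≤m+o (marks D o (length l)) _ (marks D (o + length l + length wc) (length w₂))
      (λ dc≡ → dc≢d (trans dc≡ (sym (marks-split D o l wc w₂ w≡))))

  childNode-extending : ∀ {A C w l wc w₂} (nd : Node A w) → w ≡ l ++ wc ++ w₂ → Context A C l w₂ →
    let open Node nd in
    marks E (length pre + length l) (length wc) ≡ marks E (length pre) (length w) →
    marks D (length pre + length l) (length wc) ≡ marks D (length pre) (length w) → Node C wc
  childNode-extending {w = w} {l} {wc} {w₂} nd w≡ c ec≡e dc≡d = childNode nd w≡ c unused
    (λ B B∉ → OpenLoop-extend w≡ c (proj₁ noE) (proj₂ noE) (loops B B∉))
    (subst₂ (λ e d → threshold ∣ unused ∣ e < d) (sym ec≡e) (sym dc≡d) abundant)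
    where
    open Node nd
    noE : marks E (length pre) (length l) ≡ 0 × marks E (length pre + length l + length wc) (length w₂) ≡ 0
    noE = unexcluded-outside (length pre) l wc w₂ w≡ ec≡e

  childNode-opening : ∀ {A C w l wc w₂} (nd : Node A w) → A ∈ Node.unused nd → w ≡ l ++ wc ++ w₂ → Context A C l w₂ →
    let open Node nd in
    marks E (length pre + length l) (length wc) ≡ marks E (length pre) (length w) →
    marks D (length pre + length l) (length wc) ≢ marks D (length pre) (length w) →
    threshold (∣ unused ∣ ∸ 1) (marks E (length pre + length l) (length wc)) < marks D (length pre + length l) (length wc) →
    Node C wc
  childNode-opening {A} {C} {w} {l} {wc} {w₂} nd A∈ w≡ c ec≡e dc≢d abundant′ = childNode nd w≡ c (unused - A) loops′
    (≤-<-trans (threshold-monoˡ (marks E (length pre + length l) (length wc)) (∸-monoˡ-≤ 1 (x∈p⇒∣p-x∣<∣p∣ A∈))) abundant′)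
    where
    open Node nd
    noE : marks E (length pre) (length l) ≡ 0 × marks E (length pre + length l + length wc) (length w₂) ≡ 0
    noE = unexcluded-outside (length pre) l wc w₂ w≡ ec≡e
    loops′ : OpenLoops (unused - A) C (pre ++ l) wc (w₂ ++ post)
    loops′ B B∉ with B ≟ᶠ A
    ... | yes refl = OpenLoop-new prefix c (proj₁ noE) (proj₂ noE) (distinguished-outside (length pre) l wc w₂ w≡ dc≢d)
    ... | no  B≢A  = OpenLoop-extend w≡ c (proj₁ noE) (proj₂ noE) (loops B (λ B∈ → B∉ (x∈p∧x≢y⇒x∈p-y B∈ B≢A)))

  childNode-restarting : ∀ {A C w l wc w₂} (nd : Node A w) → w ≡ l ++ wc ++ w₂ → Context A C l w₂ →
    let open Node nd in
    threshold (N G) (marks E (length pre + length l) (length wc)) < marks D (length pre + length l) (length wc) →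
    Node C wc
  childNode-restarting {l = l} {wc} nd w≡ c abundant′ = childNode nd w≡ c ⊤ (λ B B∉ → ⊥-elim (B∉ ∈⊤))
    (≤-<-trans (threshold-monoˡ (marks E (length (Node.pre nd) + length l) (length wc)) (∣p∣≤n ⊤)) abundant′)

  mutual
    descend : ∀ {A w} → Derives G A w → Node A w → Pump
    descend {A} (rule A→rhs ds) nd with A ∈? Node.unused nd
    ... | no  A∉ = OpenLoop-close (Node.loops nd A A∉) (rule A→rhs ds) (Node.splits nd)
    ... | yes A∈ = scanChildren nd A∈ A→rhs done ds refl refl (initialSurplus nd A∈ A→rhs ds)

    scanChildren : ∀ {A w rhs α β l wr} (nd : Node A w) → A ∈ Node.unused nd → (A , rhs) ∈ₗ rules G →
      DerivesSeq G α l → (ds : DerivesSeq G β wr) → rhs ≡ α ++ β → w ≡ l ++ wr → Surplus nd l ds → Pump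
    scanChildren nd A∈ A→rhs dα done _ _ ()
    scanChildren {w = w} {α = α} {l = l} nd A∈ A→rhs dα (term {a} {rest} {w′} ds) rhs≡ w≡ surplus =
      scanChildren nd A∈ A→rhs (DerivesSeq-++ dα (term done)) ds
        (trans rhs≡ (sym (++-assoc α [ inj₂ a ] rest))) (trans w≡ (sym (++-assoc l [ a ] w′)))
        (subst (λ o → sum (map T (childExcluded ds o)) < marks D o (length w′)) (sym ∣pre++l++a∣)
          (m≤n∧n+o<m+p⇒o<p (≤-trans (indicator≤1 D (length pre + length l))
                                     (1≤childThreshold ∣ unused ∣ _ (marks E (length pre + length l) 1))) surplus))
      where
      open Node nd
      T : ℕ → ℕ
      T = childThreshold ∣ unused ∣ (marks E (length pre) (length w))
      ∣pre++l++a∣ : length pre + length (l ++ [ a ]) ≡ suc (length pre + length l)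
      ∣pre++l++a∣ = trans (cong (length pre +_) (trans (length-++ l) (+-comm (length l) 1))) (+-suc (length pre) (length l))
    scanChildren nd A∈ A→rhs dα (nont dC ds) rhs≡ w≡ surplus = visitChild nd A∈ A→rhs dα dC ds rhs≡ w≡ surplus

    visitChild : ∀ {A w rhs α l C rest wc w₂} (nd : Node A w) → A ∈ Node.unused nd → (A , rhs) ∈ₗ rules G →
      DerivesSeq G α l → (dC : Derives G C wc) → (ds : DerivesSeq G rest w₂) →
      rhs ≡ α ++ inj₁ C ∷ rest → w ≡ l ++ wc ++ w₂ → Surplus nd l (nont dC ds) → Pump
    visitChild {A} {w} {α = α} {l} {C} {rest} {wc} {w₂} nd A∈ A→rhs dα dC ds rhs≡ w≡ surplus
      with marks D (length (Node.pre nd) + length l) (length wc)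
             ≤? childThreshold ∣ Node.unused nd ∣ (marks E (length (Node.pre nd)) (length w))
                  (marks E (length (Node.pre nd) + length l) (length wc))
    -- A child within its threshold is passed over, leaving the surplus to its right siblings.
    ... | yes dc≤T = scanChildren nd A∈ A→rhs
          (subst (DerivesSeq G _) (cong (l ++_) (++-identityʳ wc)) (DerivesSeq-++ dα (nont dC done))) ds
          (trans rhs≡ (sym (++-assoc α [ inj₁ C ] rest))) (trans w≡ (sym (++-assoc l wc w₂)))
          (subst (λ o → sum (map T (childExcluded ds o)) < marks D o (length w₂)) (sym ∣pre++l++wc∣)
            (m≤n∧n+o<m+p⇒o<p dc≤T (subst (T (marks E (length pre + length l) (length wc))
                                                + sum (map T (childExcluded ds (length pre + length l + length wc))) <_)
                                           (intervalSum-++ _ (length pre + length l) wc w₂) surplus)))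
      where
      open Node nd
      T : ℕ → ℕ
      T = childThreshold ∣ unused ∣ (marks E (length pre) (length w))
      ∣pre++l++wc∣ : length pre + length (l ++ wc) ≡ length pre + length l + length wc
      ∣pre++l++wc∣ = trans (cong (length pre +_) (length-++ l)) (sym (+-assoc (length pre) _ _))
    ... | no dc≰T with marks E (length (Node.pre nd) + length l) (length wc) ≟ marks E (length (Node.pre nd)) (length w)
    ...   | no ec≢e = descend dC (childNode-restarting nd w≡ (single A→rhs rhs≡ dα ds)
            (subst (_< _) (childThreshold-≢ _ _ _ ec≢e) (≰⇒> dc≰T)))
    ...   | yes ec≡e with marks D (length (Node.pre nd) + length l) (length wc) ≟ marks D (length (Node.pre nd)) (length w)
    ...     | yes dc≡d = descend dC (childNode-extending nd w≡ (single A→rhs rhs≡ dα ds) ec≡e dc≡d)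
    ...     | no  dc≢d = descend dC (childNode-opening nd A∈ w≡ (single A→rhs rhs≡ dα ds) ec≡e dc≢d
            (subst (_< _) (childThreshold-≡ _ _ _ ec≡e) (≰⇒> dc≰T)))

  pump : Derives G (start G) z → length z ≡ n → threshold (N G) ∣ E ∣ < ∣ D ∣ → Pump
  pump t ∣z∣≡n abundant = descend t record
    { pre = [] ; post = [] ; splits = ++-identityʳ z ; prefix = hole
    ; unused = ⊤ ; loops = λ B B∉ → ⊥-elim (B∉ ∈⊤)
    ; abundant = subst₂ (λ e d → threshold ∣ ⊤ {N G} ∣ e < d) (marks-all E) (marks-all D)
                   (≤-<-trans (threshold-monoˡ ∣ E ∣ (∣p∣≤n (⊤ {N G}))) abundant)
    }
    where
    marks-all : ∀ (P : Subset n) → ∣ P ∣ ≡ marks P 0 (length z)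
    marks-all P = trans (∣p∣≡marks P) (cong (marks P 0) (sym ∣z∣≡n))

-- Lists: counting, uniqueness and the pigeonhole principle

length-cartesianProduct : ∀ {A B : Set} (xs : List A) (ys : List B) →
  length (cartesianProduct xs ys) ≡ length xs * length ys
length-cartesianProduct []       ys = refl
length-cartesianProduct (x ∷ xs) ys =
  trans (length-++ (map (x ,_) ys)) (cong₂ _+_ (length-map (x ,_) ys) (length-cartesianProduct xs ys))

Unique-map-filter : ∀ {A B : Set} {P : A → Set} (P? : Decidable P) (f : A → B) xs →
  Unique (map f xs) → Unique (map f (filter P? xs))
Unique-map-filter P? f []       _           = []
Unique-map-filter P? f (x ∷ xs) (x∉ ∷ uniq) with does (P? x)
... | true  = All.map⁺ (All.filter⁺ P? (All.map⁻ x∉)) ∷ Unique-map-filter P? f xs uniq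
... | false = Unique-map-filter P? f xs uniq

lookup-injective : ∀ {A B : Set} (f : A → B) xs → Unique (map f xs) →
  ∀ i j → f (lookup xs i) ≡ f (lookup xs j) → i ≡ j
lookup-injective f (x ∷ xs) uniq         zero    zero    _ = refl
lookup-injective f (x ∷ xs) (x∉ ∷ _)     zero    (suc j) eq = ⊥-elim (All.lookup x∉ (∈-map⁺ f (∈-lookup j)) eq)
lookup-injective f (x ∷ xs) (x∉ ∷ _)     (suc i) zero    eq = ⊥-elim (All.lookup x∉ (∈-map⁺ f (∈-lookup i)) (sym eq))
lookup-injective f (x ∷ xs) (_ ∷ uniq)   (suc i) (suc j) eq = cong suc (lookup-injective f xs uniq i j eq)

sum-map-+ : ∀ {A : Set} (f g : A → ℕ) xs → sum (map (λ a → f a + g a) xs) ≡ sum (map f xs) + sum (map g xs)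
sum-map-+ f g []       = refl
sum-map-+ f g (a ∷ xs) = trans (cong (f a + g a +_) (sum-map-+ f g xs)) (interchange (f a) (g a) _ _)
  where
  interchange : ∀ m n o p → m + n + (o + p) ≡ m + o + (n + p)
  interchange = solve-∀

sum-map≤length*max : ∀ {A : Set} (f : A → ℕ) xs → A → ∃[ a ] sum (map f xs) ≤ length xs * f a
sum-map≤length*max f []       a₀ = a₀ , z≤n
sum-map≤length*max f (a ∷ xs) a₀ with sum-map≤length*max f xs a₀
... | a′ , bound with f a ≤? f a′
...   | yes fa≤fa′ = a′ , +-mono-≤ fa≤fa′ bound
...   | no  fa≰fa′ = a , +-mono-≤ ≤-refl (≤-trans bound (*-monoʳ-≤ (length xs) (<⇒≤ (≰⇒> fa≰fa′))))

module Pigeonhole {X K : Set} (_≟ₖ_ : DecidableEquality K) (key : X → K) where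

  withKey : K → List X → List X
  withKey k = filter (λ x → key x ≟ₖ k)

  hits : X → K → ℕ
  hits x k = length (withKey k [ x ])

  length-withKey-∷ : ∀ x xs k → length (withKey k (x ∷ xs)) ≡ hits x k + length (withKey k xs)
  length-withKey-∷ x xs k with key x ≟ₖ k
  ... | yes _ = refl
  ... | no  _ = refl

  1≤sum-hits : ∀ x ks → key x ∈ₗ ks → 1 ≤ sum (map (hits x) ks)
  1≤sum-hits x (k ∷ ks) (here refl) with key x ≟ₖ key x
  ... | yes _  = s≤s z≤n
  ... | no  ≢k = ⊥-elim (≢k refl)
  1≤sum-hits x (k ∷ ks) (there x∈) = ≤-trans (1≤sum-hits x ks x∈) (m≤n+m _ (hits x k))

  length≤sum-withKey : ∀ xs ks → (∀ {x} → x ∈ₗ xs → key x ∈ₗ ks) →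
    length xs ≤ sum (map (λ k → length (withKey k xs)) ks)
  length≤sum-withKey []       ks _      = z≤n
  length≤sum-withKey (x ∷ xs) ks keyed = begin
    1 + length xs
      ≤⟨ +-mono-≤ (1≤sum-hits x ks (keyed (here refl))) (length≤sum-withKey xs ks (λ x∈ → keyed (there x∈))) ⟩
    sum (map (hits x) ks) + sum (map (λ k → length (withKey k xs)) ks)
      ≡⟨ sym (sum-map-+ (hits x) (λ k → length (withKey k xs)) ks) ⟩
    sum (map (λ k → hits x k + length (withKey k xs)) ks)
      ≡⟨ cong sum (map-cong (λ k → sym (length-withKey-∷ x xs k)) ks) ⟩
    sum (map (λ k → length (withKey k (x ∷ xs))) ks) ∎
    where open ≤-Reasoning

  pigeonhole : ∀ xs ks → K → (∀ {x} → x ∈ₗ xs → key x ∈ₗ ks) → ∃[ k ] length xs ≤ length ks * length (withKey k xs)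
  pigeonhole xs ks k₀ keyed with sum-map≤length*max (λ k → length (withKey k xs)) ks k₀
  ... | k , bound = k , ≤-trans (length≤sum-withKey xs ks keyed) bound

module PumpingLemma {s : ℕ} (L : Language s) (cf : IsContextFree L) where

  G : CFG s
  G = IsContextFree.grammar cf

  open Contexts G
  open Thresholds maxRhs (N G)

  p : ℕ
  p = suc (K + 2 * S) + 16 * N G

  threshold<p*[e+1] : ∀ e → threshold (N G) e < p * (e + 1)
  threshold<p*[e+1] e = begin-strict
    threshold (N G) e       ≤⟨ threshold≤linear e ⟩
    (K + 2 * S) * suc e     <⟨ *-monoˡ-< (suc e) (n<1+n (K + 2 * S)) ⟩
    suc (K + 2 * S) * suc e ≤⟨ *-monoˡ-≤ (suc e) (m≤m+n (suc (K + 2 * S)) (16 * N G)) ⟩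
    p * suc e               ≡⟨ cong (p *_) (+-comm 1 e) ⟩
    p * (e + 1)             ∎
    where open ≤-Reasoning

  [1+n]⁴≤16*n⁴ : ∀ n → 1 ≤ n → suc n * (suc n * (suc n * suc n)) ≤ 16 * n ^ 4
  [1+n]⁴≤16*n⁴ n 1≤n = begin
    suc n * (suc n * (suc n * suc n))   ≤⟨ *-mono-≤ 1+n≤2n (*-mono-≤ 1+n≤2n (*-mono-≤ 1+n≤2n 1+n≤2n)) ⟩
    2 * n * (2 * n * (2 * n * (2 * n))) ≡⟨ expand n ⟩
    16 * n ^ 4                          ∎
    where
    open ≤-Reasoning
    1+n≤2n : suc n ≤ 2 * n
    1+n≤2n = subst (suc n ≤_) (cong (n +_) (sym (+-identityʳ n))) (subst (_≤ n + n) (+-comm n 1) (+-monoʳ-≤ n 1≤n))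
    expand : ∀ m → 2 * m * (2 * m * (2 * m * (2 * m))) ≡ 16 * (m * (m * (m * (m * 1))))
    expand = solve-∀

  PumpFamily : ∀ {n} (D E : Subset n) (k : ℕ) → (Fin k → Word s) → Set
  PumpFamily {n} D E k z =
    Σ (Fin k → Word s) λ u → Σ (Fin k → Word s) λ v → Σ (Fin k → Word s) λ w →
    Σ (Fin k → Word s) λ x → Σ (Fin k → Word s) λ y →
    (∀ i → z i ≡ u i ++ v i ++ w i ++ x i ++ y i) ×
    ∃[ lu ] ∃[ lv ] ∃[ lw ] ∃[ lx ] ∃[ ly ]
      ((∀ i → length (u i) ≡ lu × length (v i) ≡ lv × length (w i) ≡ lw ×
              length (x i) ≡ lx × length (y i) ≡ ly) ×
       (∃[ j ] (j ∈ D × OccupiedByVX lu lv lw lx (toℕ j))) ×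
       (∀ (j : Fin n) → OccupiedByVX lu lv lw lx (toℕ j) → j ∉ E) ×
       (∀ (i₀ : Fin k) (is : List (Fin k)) (iₘ₊₁ : Fin k) →
          L (u i₀ ++ concatMap v is ++ w iₘ₊₁ ++ concatMap x (reverse is) ++ y i₀)))

  emptyFamily : ∀ {n} (D E : Subset n) → ∣ E ∣ < ∣ D ∣ → (z : Fin 0 → Word s) → PumpFamily D E 0 z
  emptyFamily D E ∣E∣<∣D∣ z with ∣q∣<∣p∣⇒∃∈p∉q D E ∣E∣<∣D∣
  ... | j , j∈D , j∉E =
    none , none , none , none , none , (λ ()) , toℕ j , 1 , 0 , 0 , 0 , (λ ()) ,
    (j , j∈D , inj₁ (≤-refl , m<m+n (toℕ j) (s≤s z≤n))) , onlyJ , (λ ())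
    where
    none : Fin 0 → Word s
    none ()
    onlyJ : ∀ j′ → OccupiedByVX (toℕ j) 1 0 0 (toℕ j′) → j′ ∉ E
    onlyJ j′ (inj₁ (j≤j′ , j′<j+1)) =
      subst (_∉ E) (toℕ-injective (≤-antisym j≤j′ (≤-pred (subst (toℕ j′ <_) (+-comm (toℕ j) 1) j′<j+1)))) j∉E
    onlyJ j′ (inj₂ (j+1≤j′ , j′<j+1)) =
      ⊥-elim (<-irrefl refl (<-≤-trans (subst (toℕ j′ <_) (+-identityʳ _) j′<j+1) j+1≤j′))

  ≤-summands : ∀ {n} a b c d e → a + b + c + d + e ≡ n → a ≤ n × b ≤ n × c ≤ n × d ≤ n
  ≤-summands {n} a b c d e total =
    below (≤-trans (m≤m+n a b) (≤-trans (m≤m+n (a + b) c) (m≤m+n (a + b + c) d))) ,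
    below (≤-trans (m≤n+m b a) (≤-trans (m≤m+n (a + b) c) (m≤m+n (a + b + c) d))) ,
    below (≤-trans (m≤n+m c (a + b)) (m≤m+n (a + b + c) d)) ,
    below (m≤n+m d (a + b + c))
    where
    below : ∀ {m} → m ≤ a + b + c + d → m ≤ n
    below m≤ = subst (_ ≤_) total (≤-trans m≤ (m≤m+n (a + b + c + d) e))

  module _ {n : ℕ} (D E : Subset n) where

    open Descent G D E using (Pump; pump)

    PumpedWord : Set
    PumpedWord = Σ (Word s) λ z → Pump z × length z ≡ n

    Shape : Set
    Shape = NT × ℕ × ℕ × ℕ × ℕ

    _≟ₛ_ : DecidableEquality Shape
    _≟ₛ_ = ≡-dec _≟ᶠ_ (≡-dec _≟_ (≡-dec _≟_ (≡-dec _≟_ _≟_)))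

    shape : PumpedWord → Shape
    shape (_ , pm , _) = A , length u , length v , length w , length x
      where open Descent.Pump pm

    length-pieces : ∀ (pw : PumpedWord) → let open Descent.Pump (proj₁ (proj₂ pw)) in
      length u + length v + length w + length x + length y ≡ n
    length-pieces (z , pm , ∣z∣) = begin
      length u + length v + length w + length x + length y ≡⟨ sym (length-++₅ u v w x y) ⟩
      length (u ++ v ++ w ++ x ++ y)                       ≡⟨ cong length (sym splits) ⟩
      length z                                             ≡⟨ ∣z∣ ⟩
      n                                                    ∎
      where
      open Descent.Pump pm
      open ≡-Reasoning

    ns : List ℕ
    ns = upTo (suc n)

    shapes : List Shape
    shapes = cartesianProduct (allFin (N G)) (cartesianProduct ns (cartesianProduct ns (cartesianProduct ns ns)))

    shape∈shapes : ∀ pw → shape pw ∈ₗ shapes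
    shape∈shapes pw@(_ , pm , _) with ≤-summands _ _ _ _ _ (length-pieces pw)
    ... | u≤ , v≤ , w≤ , x≤ =
      ∈-cartesianProduct⁺ (∈-allFin _) (∈-cartesianProduct⁺ (∈-upTo⁺ (s≤s u≤))
        (∈-cartesianProduct⁺ (∈-upTo⁺ (s≤s v≤)) (∈-cartesianProduct⁺ (∈-upTo⁺ (s≤s w≤)) (∈-upTo⁺ (s≤s x≤)))))

    length-shapes≤ : 1 ≤ n → length shapes ≤ p * n ^ 4
    length-shapes≤ 1≤n = begin
      length shapes                             ≡⟨ length-shapes ⟩
      N G * (suc n * (suc n * (suc n * suc n))) ≤⟨ *-monoʳ-≤ (N G) ([1+n]⁴≤16*n⁴ n 1≤n) ⟩
      N G * (16 * n ^ 4)                        ≡⟨ sym (*-assoc (N G) 16 (n ^ 4)) ⟩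
      N G * 16 * n ^ 4                          ≤⟨ *-monoˡ-≤ (n ^ 4) 16N≤p ⟩
      p * n ^ 4                                 ∎
      where
      open ≤-Reasoning
      16N≤p : N G * 16 ≤ p
      16N≤p = ≤-trans (≤-reflexive (*-comm (N G) 16)) (m≤n+m (16 * N G) (suc (K + 2 * S)))
      ∣ns∣ : length ns ≡ suc n
      ∣ns∣ = length-upTo (suc n)
      length-shapes : length shapes ≡ N G * (suc n * (suc n * (suc n * suc n)))
      length-shapes = begin-equality
        length shapes
          ≡⟨ length-cartesianProduct (allFin (N G)) (cartesianProduct ns (cartesianProduct ns (cartesianProduct ns ns))) ⟩
        length (allFin (N G)) * length (cartesianProduct ns (cartesianProduct ns (cartesianProduct ns ns)))
          ≡⟨ cong₂ _*_ (length-tabulate {n = N G} (λ i → i))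
               (trans (length-cartesianProduct ns (cartesianProduct ns (cartesianProduct ns ns))) (cong₂ _*_ ∣ns∣
                 (trans (length-cartesianProduct ns (cartesianProduct ns ns)) (cong₂ _*_ ∣ns∣
                   (trans (length-cartesianProduct ns ns) (cong₂ _*_ ∣ns∣ ∣ns∣)))))) ⟩
        N G * (suc n * (suc n * (suc n * suc n))) ∎

    record ShapedPump (A : NT) (lu lv lw lx : ℕ) (z : Word s) : Set where
      field
        u v w x y : Word s
        prefix : Context (start G) A u y
        loop : Context A A v x
        core : Derives G A w
        splits : z ≡ u ++ v ++ w ++ x ++ y
        lengths : length u ≡ lu × length v ≡ lv × length w ≡ lw × length x ≡ lx ×
                  length y ≡ n ∸ (lu + lv + lw + lx)
        distinguished : 1 ≤ marks D lu lv + marks D (lu + lv + lw) lx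
        excludedᵛ : marks E lu lv ≡ 0
        excludedˣ : marks E (lu + lv + lw) lx ≡ 0

    shaped : ∀ {A lu lv lw lx} (pw : PumpedWord) → shape pw ≡ (A , lu , lv , lw , lx) →
      ShapedPump A lu lv lw lx (proj₁ pw)
    shaped pw@(z , pm , _) refl = record
      { u = u ; v = v ; w = w ; x = x ; y = y
      ; prefix = prefix ; loop = loop ; core = core ; splits = splits
      ; lengths = refl , refl , refl , refl ,
          trans (sym (m+n∸m≡n (length u + length v + length w + length x) (length y)))
                (cong (_∸ (length u + length v + length w + length x)) (length-pieces pw))
      ; distinguished = distinguished ; excludedᵛ = excludedᵛ ; excludedˣ = excludedˣ
      }
      where open Descent.Pump pm

    shapedFamily : ∀ {k A lu lv lw lx} (z : Fin k → Word s) → (∀ i → ShapedPump A lu lv lw lx (z i)) →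
      Fin k → PumpFamily D E k z
    shapedFamily {lu = lu} {lv} {lw} {lx} z sp r =
      u , v , w , x , y , (λ i → ShapedPump.splits (sp i)) ,
      lu , lv , lw , lx , _ , (λ i → ShapedPump.lengths (sp i)) ,
      marked⇒occupied D lu lv lw lx distinguished ,
      unmarked⇒¬occupied E lu lv lw lx excludedᵛ excludedˣ ,
      λ i₀ is iₘ₊₁ → Equivalence.from (IsContextFree.generates cf _)
        (pumped u v w x y (λ i → ShapedPump.prefix (sp i)) (λ i → ShapedPump.loop (sp i))
                          (λ i → ShapedPump.core (sp i)) i₀ is iₘ₊₁)
      where
      open ShapedPump (sp r) using (distinguished; excludedᵛ; excludedˣ)
      u v w x y : Fin _ → Word s
      u i = ShapedPump.u (sp i)
      v i = ShapedPump.v (sp i)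
      w i = ShapedPump.w (sp i)
      x i = ShapedPump.x (sp i)
      y i = ShapedPump.y (sp i)

    familyOf : ∀ {A lu lv lw lx} (F : List PumpedWord) → All (λ pw → shape pw ≡ (A , lu , lv , lw , lx)) F →
      ∣ E ∣ < ∣ D ∣ → PumpFamily D E (length F) (λ i → proj₁ (lookup F i))
    familyOf []          _    ∣E∣<∣D∣ = emptyFamily D E ∣E∣<∣D∣ _
    familyOf F@(_ ∷ _)   same _       =
      shapedFamily _ (λ i → shaped (lookup F i) (All.lookup same (∈-lookup i))) zero

    pumpAll : threshold (N G) ∣ E ∣ < ∣ D ∣ → ∀ R → All L R → All (λ z → length z ≡ n) R →
      Σ (List PumpedWord) λ pws → map proj₁ pws ≡ R
    pumpAll abundant []      []            []            = [] , refl
    pumpAll abundant (z ∷ R) (z∈L ∷ inL) (∣z∣ ∷ lengths) with pumpAll abundant R inL lengths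
    ... | pws , ≡R = (z , pump z (Equivalence.to (IsContextFree.generates cf z) z∈L) ∣z∣ abundant , ∣z∣) ∷ pws
                   , cong (z ∷_) ≡R

    open Pigeonhole _≟ₛ_ shape using (withKey; pigeonhole)

    conclusion : ∀ R → Unique R → All L R → All (λ z → length z ≡ n) R → ∣ D ∣ ≥ p * (∣ E ∣ + 1) →
      ∃[ k ] Σ (Fin k → Word s) λ z →
        Injective _≡_ _≡_ z × (∀ i → z i ∈ₗ R) × length R ≤ p * n ^ 4 * k × PumpFamily D E k z
    conclusion R uniq inL lengths many
      with pumpAll (<-≤-trans (threshold<p*[e+1] ∣ E ∣) many) R inL lengths
    ... | pws , ≡R with pigeonhole pws shapes (start G , 0 , 0 , 0 , 0) (λ {pw} _ → shape∈shapes pw)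
    ...   | σ , crowded =
      length F , z , (λ {i} {j} → lookup-injective proj₁ F uniqF i j) , z∈R , bound ,
      familyOf F (All.all-filter (λ pw → shape pw ≟ₛ σ) pws) ∣E∣<∣D∣
      where
      F : List PumpedWord
      F = withKey σ pws
      z : Fin (length F) → Word s
      z i = proj₁ (lookup F i)
      uniqF : Unique (map proj₁ F)
      uniqF = Unique-map-filter (λ pw → shape pw ≟ₛ σ) proj₁ pws (subst Unique (sym ≡R) uniq)
      z∈R : ∀ i → z i ∈ₗ R
      z∈R i = subst (z i ∈ₗ_) ≡R (∈-map⁺ proj₁ (proj₁ (∈-filter⁻ (λ pw → shape pw ≟ₛ σ) (∈-lookup i))))
      ∣E∣<∣D∣ : ∣ E ∣ < ∣ D ∣
      ∣E∣<∣D∣ = <-≤-trans (m<m+n ∣ E ∣ (s≤s z≤n)) (≤-trans (m≤n*m (∣ E ∣ + 1) p) many)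
      bound : length R ≤ p * n ^ 4 * length F
      bound = begin
        length R                 ≡⟨ trans (cong length (sym ≡R)) (length-map proj₁ pws) ⟩
        length pws               ≤⟨ crowded ⟩
        length shapes * length F ≤⟨ *-monoˡ-≤ (length F) (length-shapes≤ 1≤n) ⟩
        p * n ^ 4 * length F     ∎
        where
        open ≤-Reasoning
        1≤n : 1 ≤ n
        1≤n = ≤-trans (s≤s z≤n) (<-≤-trans ∣E∣<∣D∣ (∣p∣≤n D))

lemma3 : ∀ {s} (L : Language s) → IsContextFree L →
  ∃[ p ] (p > 0 ×
    ((n : ℕ) (R : List (Word s)) → Unique R → All L R → All (λ z → length z ≡ n) R →
     (D E : Subset n) → ∣ D ∣ ≥ p * (∣ E ∣ + 1) →
     ∃[ k ] Σ (Fin k → Word s) λ z →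
       Injective _≡_ _≡_ z × (∀ i → z i ∈ₗ R) × length R ≤ p * n ^ 4 * k ×
       Σ (Fin k → Word s) λ u → Σ (Fin k → Word s) λ v → Σ (Fin k → Word s) λ w →
       Σ (Fin k → Word s) λ x → Σ (Fin k → Word s) λ y →
       (∀ i → z i ≡ u i ++ v i ++ w i ++ x i ++ y i) ×
       ∃[ lu ] ∃[ lv ] ∃[ lw ] ∃[ lx ] ∃[ ly ]
         ((∀ i → length (u i) ≡ lu × length (v i) ≡ lv × length (w i) ≡ lw ×
                 length (x i) ≡ lx × length (y i) ≡ ly) ×
          (∃[ j ] (j ∈ D × OccupiedByVX lu lv lw lx (toℕ j))) ×
          (∀ (j : Fin n) → OccupiedByVX lu lv lw lx (toℕ j) → j ∉ E) ×
          (∀ (i₀ : Fin k) (is : List (Fin k)) (iₘ₊₁ : Fin k) →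
             L (u i₀ ++ concatMap v is ++ w iₘ₊₁ ++ concatMap x (reverse is) ++ y i₀)))))
lemma3 L cf = p , s≤s z≤n , λ n R uniq inL lengths D E many → conclusion D E R uniq inL lengths many
  where open PumpingLemma L cf
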